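{- Let $T$ be a tree and $u$ a vertex of $T$ with $u\in\mathcal{N}_T$. Suppose $u$ is adjacent to exactly $p$ vertices that are isolated vertices of the induced subgraph $T[\mathcal{A}_T]$ and to exactly $q$ vertices that are end-vertices of isolated edges of $T[\mathcal{A}_T]$ (edges forming a connected component of $T[\mathcal{A}_T]$). Then $p+2q\geq 4$ or $p=3$. Consequently, if $\mathcal{N}_T\neq\emptyset$, then $|\mathcal{A}_T|\geq 3$.
   Context: A dissociation set of a graph $G$ is a set $S$ of vertices such that $G[S]$ has maximum degree at most $1$; a maximum dissociation set is one of maximum cardinality. $\mathcal{A}_T$ denotes the set of vertices of $T$ that belong to every maximum dissociation set of $T$, and $\mathcal{N}_T$ denotes the set of vertices of $T$ that belong to no maximum dissociation set of $T$. -}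

module Defs where

open import Data.Nat using (ℕ; zero; suc; _+_; _*_; _≤_)
open import Data.Fin using (Fin)
open import Data.Fin.Subset using (Subset; _∈_; _∉_; ∣_∣)
open import Data.Bool using (Bool; T)
open import Data.List using (List; []; _∷_; length; _∷ʳ_)
open import Data.List.Relation.Unary.Linked using (Linked)
open import Data.List.Relation.Unary.Unique.Propositional using (Unique)
open import Data.Product using (Σ; _×_; _,_; ∃)
open import Relation.Binary.PropositionalEquality using (_≡_; _≢_)
open import Relation.Nullary using (¬_)

record Graph (n : ℕ) : Set where
  field
    adj   : Fin n → Fin n → Bool
    sym   : ∀ x y → adj x y ≡ adj y x
    irrefl : ∀ x → ¬ T (adj x x)

module _ {n : ℕ} (G : Graph n) where
  open Graph G

  Adj : Fin n → Fin n → Set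
  Adj x y = T (adj x y)

  data Reachable : Fin n → Fin n → Set where
    here : ∀ {x} → Reachable x x
    step : ∀ {x y z} → Adj x y → Reachable y z → Reachable x z

  Connected : Set
  Connected = ∀ x y → Reachable x y

  record Cycle : Set where
    field
      start : Fin n
      rest  : List (Fin n)
      long  : 2 ≤ length rest
      distinct : Unique (start ∷ rest)
      closed : Linked Adj (start ∷ rest ∷ʳ start)

  Acyclic : Set
  Acyclic = ¬ Cycle

  IsTree : Set
  IsTree = Connected × Acyclic

  -- dissociation set: induced subgraph has maximum degree at most 1
  IsDissociation : Subset n → Set
  IsDissociation S = ∀ v x y → v ∈ S → x ∈ S → y ∈ S → Adj v x → Adj v y → x ≡ y

  IsMaxDissociation : Subset n → Set
  IsMaxDissociation S = IsDissociation S × (∀ S′ → IsDissociation S′ → ∣ S′ ∣ ≤ ∣ S ∣)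

  -- 𝒜_T : in every maximum dissociation set
  InA : Fin n → Set
  InA v = ∀ S → IsMaxDissociation S → v ∈ S

  -- 𝒩_T : in no maximum dissociation set
  InN : Fin n → Set
  InN v = ∀ S → IsMaxDissociation S → v ∉ S

  IsolatedInA : Fin n → Set
  IsolatedInA v = InA v × (∀ x → InA x → ¬ Adj v x)

  IsolatedEdgeEndInA : Fin n → Set
  IsolatedEdgeEndInA v =
    Σ (Fin n) λ w → InA v × InA w × Adj v w ×
      (∀ x → InA x → Adj v x → x ≡ w) × (∀ x → InA x → Adj w x → x ≡ v)

-- Let u ∈ 𝒩.  If B is the branch of T − u at a neighbour of u, then splicing a maximum dissociation
-- set on B into another one off B yields a maximum dissociation set: no edge leaves B except towards
-- u, which lies in neither set.  Such exchanges give a maximum set Z all of whose neighbours of u lie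
-- in 𝒜.  Z contains two neighbours x, y of u, since otherwise adding u to Z, possibly after removing
-- one vertex, gives a maximum set containing u.  If x is isolated in T[𝒜], a further exchange makes
-- x free of other neighbours in Z, and then u needs a third neighbour in 𝒜, since otherwise trading
-- y for u again gives a maximum set containing u.  So either q ≥ 2 or p + q ≥ 3, which yields
-- p + 2q ≥ 4 or p = 3; and 𝒜 has a third vertex besides x and y, either that neighbour of u or, when
-- x ends an isolated edge of T[𝒜], its partner (T has no triangles).
-- Membership in 𝒜 and 𝒩 is not decidable, so the argument runs in the double-negation monad, which
-- the decidable conclusions allow us to leave.

module Submission where

open import Defs
open import Data.Bool using (true; false; T)
open import Data.Empty using (⊥; ⊥-elim)
open import Data.Fin using (Fin; zero; suc)
open import Data.Fin.Properties using (_≟_; any?)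
open import Data.Fin.Subset using (Subset; _∈_; _∉_; _⊆_; ∣_∣; ⁅_⁆; _∪_; _∩_; ∁; _─_; _-_) renaming (⊥ to ∅)
open import Data.Fin.Subset.Properties
  using (p─⊥≡p; ∪-identityʳ; x∈p∪q⁻; x∈p∪q⁺; x∈p∩q⁻; x∈∁p⇒x∉p;
         x∈p⇒∣p-x∣<∣p∣; x∈p∧x≢y⇒x∈p-y; x∈⁅x⁆; x∈⁅y⁆⇒x≡y; drop-there; _∈?_; ∉⊥; ∣p∣≤n; p─q⊆p)
open import Data.List using (List; []; _∷_; _∷ʳ_; drop; allFin)
open import Data.List.Membership.Propositional using () renaming (_∈_ to _∈ₗ_)
open import Data.List.Membership.Propositional.Properties using (∈-allFin)
open import Data.List.Relation.Unary.All using (All; []; _∷_)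
import Data.List.Relation.Unary.All as All
open import Data.List.Relation.Unary.AllPairs using ([]; _∷_)
import Data.List.Relation.Unary.All.Properties as Allₚ
open import Data.List.Relation.Unary.Linked using (Linked; []; [-]; _∷_)
open import Data.List.Relation.Unary.Any using (here; there)
import Data.List.Relation.Unary.Any as Any
open import Data.List.Relation.Unary.Unique.Propositional using (Unique)
import Data.List.Relation.Unary.Unique.Propositional.Properties as Uniqueₚ
open import Data.Nat using (ℕ; zero; suc; _+_; _*_; _≤_; _<_; s≤s; z≤n)
open import Data.Nat.Properties
  using (+-suc; +-comm; +-assoc; +-identityʳ; +-mono-≤; +-monoʳ-≤; *-monoʳ-≤; +-cancelˡ-≤; m≤n+m; m≤n⇒m≤1+n;
         m≤n⇒m<n∨m≡n; ≤-trans; ≤-reflexive; 1+n≰n; ≰⇒>; _≤?_; module ≤-Reasoning)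
  renaming (_≟_ to _≟ℕ_)
open import Data.Product using (Σ; ∃; ∃₂; _×_; _,_; proj₁; proj₂)
open import Data.Sum using (_⊎_; inj₁; inj₂)
import Data.Sum as Sum
open import Data.Vec using ([]; _∷_; here; there)
open import Effect.Monad using (RawMonad)
open import Function using (_∘_)
open import Function.Bundles using (_⇔_; mk⇔; Equivalence)
open import Level using (0ℓ)
open import Relation.Binary.PropositionalEquality using (_≡_; _≢_; refl; sym; trans; cong; subst; ≢-sym; module ≡-Reasoning)
open import Relation.Nullary using (¬_; ¬?; Dec; yes; no; _×-dec_)
open import Relation.Nullary.Decidable using (_⊎-dec_; ¬¬-excluded-middle; T?; decidable-stable)
open import Relation.Nullary.Negation using (¬¬-Monad)

open RawMonad (¬¬-Monad {0ℓ}) using (_>>=_; return)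
open Equivalence using (to; from)

private
  variable
    n : ℕ
    a b u v w x y z : Fin n
    xs ys : List (Fin n)

x∈p─q⇒x∉q : ∀ (p q : Subset n) → x ∈ p ─ q → x ∉ q
x∈p─q⇒x∉q (true ∷ p) (false ∷ q) here ()
x∈p─q⇒x∉q (_ ∷ p)    (_ ∷ q)     (there x∈p─q) (there x∈q) = x∈p─q⇒x∉q p q x∈p─q x∈q

x∈p-y⇒x≢y : ∀ (p : Subset n) → x ∈ p - y → x ≢ y
x∈p-y⇒x≢y {y = y} p x∈p-y refl = x∈p─q⇒x∉q p ⁅ y ⁆ x∈p-y (x∈⁅x⁆ y)

x∈p⇒suc∣p-x∣≡∣p∣ : ∀ {p : Subset n} → x ∈ p → suc ∣ p - x ∣ ≡ ∣ p ∣
x∈p⇒suc∣p-x∣≡∣p∣ {x = zero}  {true ∷ p}  here          = cong (suc ∘ ∣_∣) (p─⊥≡p p)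
x∈p⇒suc∣p-x∣≡∣p∣ {x = suc x} {true ∷ p}  (there x∈p) = cong suc (x∈p⇒suc∣p-x∣≡∣p∣ x∈p)
x∈p⇒suc∣p-x∣≡∣p∣ {x = suc x} {false ∷ p} (there x∈p) = x∈p⇒suc∣p-x∣≡∣p∣ x∈p

x∉p⇒∣p∪⁅x⁆∣≡suc∣p∣ : ∀ {p : Subset n} → x ∉ p → ∣ p ∪ ⁅ x ⁆ ∣ ≡ suc ∣ p ∣
x∉p⇒∣p∪⁅x⁆∣≡suc∣p∣ {x = zero}  {true ∷ p}  x∉p = ⊥-elim (x∉p here)
x∉p⇒∣p∪⁅x⁆∣≡suc∣p∣ {x = zero}  {false ∷ p} x∉p = cong (suc ∘ ∣_∣) (∪-identityʳ p)
x∉p⇒∣p∪⁅x⁆∣≡suc∣p∣ {x = suc x} {true ∷ p}  x∉p = cong suc (x∉p⇒∣p∪⁅x⁆∣≡suc∣p∣ (x∉p ∘ there))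
x∉p⇒∣p∪⁅x⁆∣≡suc∣p∣ {x = suc x} {false ∷ p} x∉p = x∉p⇒∣p∪⁅x⁆∣≡suc∣p∣ (x∉p ∘ there)

∣p∪q∣≤∣p∣+∣q∣ : ∀ (p q : Subset n) → ∣ p ∪ q ∣ ≤ ∣ p ∣ + ∣ q ∣
∣p∪q∣≤∣p∣+∣q∣ []          []          = z≤n
∣p∪q∣≤∣p∣+∣q∣ (true ∷ p)  (true ∷ q)  = s≤s (subst (∣ p ∪ q ∣ ≤_) (sym (+-suc _ _)) (m≤n⇒m≤1+n (∣p∪q∣≤∣p∣+∣q∣ p q)))
∣p∪q∣≤∣p∣+∣q∣ (true ∷ p)  (false ∷ q) = s≤s (∣p∪q∣≤∣p∣+∣q∣ p q)
∣p∪q∣≤∣p∣+∣q∣ (false ∷ p) (true ∷ q)  = subst (suc ∣ p ∪ q ∣ ≤_) (sym (+-suc _ _)) (s≤s (∣p∪q∣≤∣p∣+∣q∣ p q))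
∣p∪q∣≤∣p∣+∣q∣ (false ∷ p) (false ∷ q) = ∣p∪q∣≤∣p∣+∣q∣ p q

x∈p∪⁅y⁆⁻ : ∀ {p : Subset n} → x ∈ p ∪ ⁅ y ⁆ → x ∈ p ⊎ x ≡ y
x∈p∪⁅y⁆⁻ {y = y} {p} x∈ = Sum.map₂ (x∈⁅y⁆⇒x≡y y) (x∈p∪q⁻ p ⁅ y ⁆ x∈)

splice : Subset n → Subset n → Subset n → Subset n
splice B P Q = B ∩ P ∪ ∁ B ∩ Q

module _ {B P Q : Subset n} where

  ∈-splice⁻ : x ∈ splice B P Q → (x ∈ B × x ∈ P) ⊎ (x ∉ B × x ∈ Q)
  ∈-splice⁻ x∈S with x∈p∪q⁻ (B ∩ P) (∁ B ∩ Q) x∈S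
  ... | inj₁ x∈B∩P = inj₁ (x∈p∩q⁻ B P x∈B∩P)
  ... | inj₂ x∈∁B∩Q = let x∈∁B , x∈Q = x∈p∩q⁻ (∁ B) Q x∈∁B∩Q in inj₂ (x∈∁p⇒x∉p x∈∁B , x∈Q)

  ∈-spliceˡ⁻ : x ∈ B → x ∈ splice B P Q → x ∈ P
  ∈-spliceˡ⁻ x∈B x∈S with ∈-splice⁻ x∈S
  ... | inj₁ (_ , x∈P)   = x∈P
  ... | inj₂ (x∉B , _) = ⊥-elim (x∉B x∈B)

  ∈-spliceʳ⁻ : x ∉ B → x ∈ splice B P Q → x ∈ Q
  ∈-spliceʳ⁻ x∉B x∈S with ∈-splice⁻ x∈S
  ... | inj₁ (x∈B , _) = ⊥-elim (x∉B x∈B)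
  ... | inj₂ (_ , x∈Q)   = x∈Q

∣splice∣+∣splice∣≡∣p∣+∣q∣ : ∀ (B P Q : Subset n) → ∣ splice B P Q ∣ + ∣ splice B Q P ∣ ≡ ∣ P ∣ + ∣ Q ∣
∣splice∣+∣splice∣≡∣p∣+∣q∣ []          []          []          = refl
∣splice∣+∣splice∣≡∣p∣+∣q∣ (true ∷ B) (false ∷ P) (false ∷ Q) = ∣splice∣+∣splice∣≡∣p∣+∣q∣ B P Q
∣splice∣+∣splice∣≡∣p∣+∣q∣ (false ∷ B) (false ∷ P) (false ∷ Q) = ∣splice∣+∣splice∣≡∣p∣+∣q∣ B P Q
∣splice∣+∣splice∣≡∣p∣+∣q∣ (true ∷ B) (true ∷ P) (false ∷ Q) = cong suc (∣splice∣+∣splice∣≡∣p∣+∣q∣ B P Q)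
∣splice∣+∣splice∣≡∣p∣+∣q∣ (false ∷ B) (false ∷ P) (true ∷ Q) =
  trans (cong suc (∣splice∣+∣splice∣≡∣p∣+∣q∣ B P Q)) (sym (+-suc ∣ P ∣ ∣ Q ∣))
∣splice∣+∣splice∣≡∣p∣+∣q∣ (true ∷ B) (false ∷ P) (true ∷ Q) =
  trans (+-suc _ _) (trans (cong suc (∣splice∣+∣splice∣≡∣p∣+∣q∣ B P Q)) (sym (+-suc ∣ P ∣ ∣ Q ∣)))
∣splice∣+∣splice∣≡∣p∣+∣q∣ (false ∷ B) (true ∷ P) (false ∷ Q) =
  trans (+-suc _ _) (cong suc (∣splice∣+∣splice∣≡∣p∣+∣q∣ B P Q))
∣splice∣+∣splice∣≡∣p∣+∣q∣ (true ∷ B) (true ∷ P) (true ∷ Q) =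
  cong suc (trans (+-suc _ _) (trans (cong suc (∣splice∣+∣splice∣≡∣p∣+∣q∣ B P Q)) (sym (+-suc ∣ P ∣ ∣ Q ∣))))
∣splice∣+∣splice∣≡∣p∣+∣q∣ (false ∷ B) (true ∷ P) (true ∷ Q) =
  cong suc (trans (+-suc _ _) (trans (cong suc (∣splice∣+∣splice∣≡∣p∣+∣q∣ B P Q)) (sym (+-suc ∣ P ∣ ∣ Q ∣))))

x∈p⇒1≤∣p∣ : ∀ {p : Subset n} → x ∈ p → 1 ≤ ∣ p ∣
x∈p⇒1≤∣p∣ x∈p = ≤-trans (s≤s z≤n) (x∈p⇒∣p-x∣<∣p∣ x∈p)

distinct∈p⇒2≤∣p∣ : ∀ {p : Subset n} → x ∈ p → y ∈ p → y ≢ x → 2 ≤ ∣ p ∣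
distinct∈p⇒2≤∣p∣ x∈p y∈p y≢x = ≤-trans (s≤s (x∈p⇒1≤∣p∣ (x∈p∧x≢y⇒x∈p-y y∈p y≢x))) (x∈p⇒∣p-x∣<∣p∣ x∈p)

distinct∈p⇒3≤∣p∣ : ∀ {p : Subset n} {z} → x ∈ p → y ∈ p → z ∈ p → y ≢ x → z ≢ x → z ≢ y → 3 ≤ ∣ p ∣
distinct∈p⇒3≤∣p∣ x∈p y∈p z∈p y≢x z≢x z≢y =
  ≤-trans (s≤s (distinct∈p⇒2≤∣p∣ (x∈p∧x≢y⇒x∈p-y y∈p y≢x) (x∈p∧x≢y⇒x∈p-y z∈p z≢x) z≢y)) (x∈p⇒∣p-x∣<∣p∣ x∈p)

¬¬-comprehension : (P : Fin n → Set) → ¬ ¬ (Σ (Subset n) λ X → ∀ v → v ∈ X ⇔ P v)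
¬¬-comprehension {zero}  P = return ([] , λ ())
¬¬-comprehension {suc n} P = do
  X , X⇔P∘suc ← ¬¬-comprehension (P ∘ suc)
  P0? ← ¬¬-excluded-middle
  return (extend P0? X⇔P∘suc)
  where
  tail⇔ : ∀ {b X} → (∀ v → v ∈ X ⇔ P (suc v)) → ∀ v → suc v ∈ b ∷ X ⇔ P (suc v)
  tail⇔ X⇔ v = mk⇔ (to (X⇔ v) ∘ drop-there) (there ∘ from (X⇔ v))
  extend : ∀ {X} → Dec (P zero) → (∀ v → v ∈ X ⇔ P (suc v)) → Σ (Subset (suc n)) λ Y → ∀ v → v ∈ Y ⇔ P v
  extend (yes P0) X⇔ = true ∷ _ , λ where
    zero    → mk⇔ (λ _ → P0) (λ _ → here)
    (suc v) → tail⇔ X⇔ v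
  extend (no ¬P0) X⇔ = false ∷ _ , λ where
    zero    → mk⇔ (λ ()) (⊥-elim ∘ ¬P0)
    (suc v) → tail⇔ X⇔ v

2≤q⇒4≤p+2q : ∀ p q → 2 ≤ q → 4 ≤ p + 2 * q
2≤q⇒4≤p+2q p q 2≤q = ≤-trans (*-monoʳ-≤ 2 2≤q) (m≤n+m (2 * q) p)

3≤p+q⇒4≤p+2q⊎p≡3 : ∀ p q → 3 ≤ p + q → 4 ≤ p + 2 * q ⊎ p ≡ 3
3≤p+q⇒4≤p+2q⊎p≡3 p zero 3≤p+0 with m≤n⇒m<n∨m≡n 3≤p+0
... | inj₁ 3<p+0 = inj₁ 3<p+0
... | inj₂ 3≡p+0 = inj₂ (trans (sym (+-identityʳ p)) (sym 3≡p+0))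
3≤p+q⇒4≤p+2q⊎p≡3 p q@(suc _) 3≤p+q = inj₁ (begin
  4             ≤⟨ +-mono-≤ 3≤p+q (s≤s z≤n) ⟩
  p + q + q     ≡⟨ +-assoc p q q ⟩
  p + (q + q)   ≡⟨ cong (λ r → p + (q + r)) (+-identityʳ q) ⟨
  p + 2 * q     ∎)
  where open ≤-Reasoning

m+n≡o+p∧n≤o⇒p≤m : ∀ m n o p → m + n ≡ o + p → n ≤ o → p ≤ m
m+n≡o+p∧n≤o⇒p≤m m n o p m+n≡o+p n≤o = +-cancelˡ-≤ o p m (begin
  o + p ≡⟨ m+n≡o+p ⟨
  m + n ≤⟨ +-monoʳ-≤ m n≤o ⟩
  m + o ≡⟨ +-comm m o ⟩
  o + m ∎)
  where open ≤-Reasoning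

module _ (G : Graph n) where

  private
    _~_ : Fin n → Fin n → Set
    x ~ y = Adj G x y

    _~?_ : ∀ x y → Dec (x ~ y)
    x ~? y = T? (Graph.adj G x y)

    Dissociation : Subset n → Set
    Dissociation = IsDissociation G

    Maximum : Subset n → Set
    Maximum = IsMaxDissociation G

  ~-sym : x ~ y → y ~ x
  ~-sym {x} {y} = subst T (Graph.sym G x y)

  ~⇒≢ : x ~ y → x ≢ y
  ~⇒≢ {x} x~y refl = Graph.irrefl G x x~y

  ∅-dissociation : Dissociation ∅
  ∅-dissociation _ _ _ v∈∅ = ⊥-elim (∉⊥ v∈∅)

  dissociation-⊆ : ∀ {S T} → S ⊆ T → Dissociation T → Dissociation S
  dissociation-⊆ S⊆T dT v x y v∈S x∈S y∈S = dT v x y (S⊆T v∈S) (S⊆T x∈S) (S⊆T y∈S)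

  splice-dissociation : ∀ {B P Q} → Dissociation P → Dissociation Q →
    (∀ {p q} → p ∈ B → q ∉ B → p ~ q → p ∈ P → q ∈ Q → ⊥) → Dissociation (splice B P Q)
  splice-dissociation {B} {P} {Q} dP dQ no-crossing v x y v∈S x∈S y∈S v~x v~y with v ∈? B
  ... | yes v∈B = dP v x y (∈-spliceˡ⁻ v∈B v∈S) (inside-B x∈S v~x) (inside-B y∈S v~y) v~x v~y
    where
    inside-B : ∀ {x} → x ∈ splice B P Q → v ~ x → x ∈ P
    inside-B {x} x∈S v~x with x ∈? B
    ... | yes x∈B = ∈-spliceˡ⁻ x∈B x∈S
    ... | no x∉B  = ⊥-elim (no-crossing v∈B x∉B v~x (∈-spliceˡ⁻ v∈B v∈S) (∈-spliceʳ⁻ x∉B x∈S))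
  ... | no v∉B = dQ v x y (∈-spliceʳ⁻ v∉B v∈S) (outside-B x∈S v~x) (outside-B y∈S v~y) v~x v~y
    where
    outside-B : ∀ {x} → x ∈ splice B P Q → v ~ x → x ∈ Q
    outside-B {x} x∈S v~x with x ∈? B
    ... | yes x∈B = ⊥-elim (no-crossing x∈B v∉B (~-sym v~x) (∈-spliceˡ⁻ x∈B x∈S) (∈-spliceʳ⁻ v∉B v∈S))
    ... | no x∉B  = ∈-spliceʳ⁻ x∉B x∈S

  insert-dissociation : ∀ {D} → Dissociation D → (∀ {y} → y ∈ D → u ~ y → y ≡ x) →
    (∀ {z} → z ∈ D → ¬ x ~ z) → Dissociation (D ∪ ⁅ u ⁆)
  insert-dissociation {u = u} {x = x} {D = D} dD only-x x-free v a b v∈ a∈ b∈ v~a v~b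
    with x∈p∪⁅y⁆⁻ v∈ | x∈p∪⁅y⁆⁻ a∈ | x∈p∪⁅y⁆⁻ b∈
  ... | inj₂ refl | inj₂ refl | _         = ⊥-elim (~⇒≢ v~a refl)
  ... | inj₂ refl | _         | inj₂ refl = ⊥-elim (~⇒≢ v~b refl)
  ... | inj₂ refl | inj₁ a∈D  | inj₁ b∈D  = trans (only-x a∈D v~a) (sym (only-x b∈D v~b))
  ... | inj₁ _    | inj₂ refl | inj₂ refl = refl
  ... | inj₁ v∈D  | inj₂ refl | inj₁ b∈D  = ⊥-elim (x-free b∈D (subst (_~ b) (only-x v∈D (~-sym v~a)) v~b))
  ... | inj₁ v∈D  | inj₁ a∈D  | inj₂ refl = ⊥-elim (x-free a∈D (subst (_~ a) (only-x v∈D (~-sym v~b)) v~a))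
  ... | inj₁ v∈D  | inj₁ a∈D  | inj₁ b∈D  = dD v a b v∈D a∈D b∈D v~a v~b

  maximum-by-size : ∀ {S D} → Maximum S → Dissociation D → ∣ S ∣ ≤ ∣ D ∣ → Maximum D
  maximum-by-size (_ , maxS) dD ∣S∣≤∣D∣ = dD , λ S′ dS′ → ≤-trans (maxS S′ dS′) ∣S∣≤∣D∣

  ¬¬-maximum : ¬ ¬ Σ (Subset n) Maximum
  ¬¬-maximum ¬max = ¬¬-large (suc n) λ (S , _ , n<∣S∣) → 1+n≰n (≤-trans n<∣S∣ (∣p∣≤n S))
    where
    ¬¬-larger : ∀ S → Dissociation S → ¬ ¬ Σ (Subset n) λ S′ → Dissociation S′ × ∣ S ∣ < ∣ S′ ∣
    ¬¬-larger S dS ¬larger = ¬max (S , dS , λ S′ dS′ →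
      decidable-stable (∣ S′ ∣ ≤? ∣ S ∣) λ ∣S′∣≰∣S∣ → ¬larger (S′ , dS′ , ≰⇒> ∣S′∣≰∣S∣))

    ¬¬-large : ∀ k → ¬ ¬ Σ (Subset n) λ S → Dissociation S × k ≤ ∣ S ∣
    ¬¬-large zero    = return (∅ , ∅-dissociation , z≤n)
    ¬¬-large (suc k) = do
      S  , dS  , k≤∣S∣     ← ¬¬-large k
      S′ , dS′ , ∣S∣<∣S′∣ ← ¬¬-larger S dS
      return (S′ , dS′ , ≤-trans (s≤s k≤∣S∣) ∣S∣<∣S′∣)

  ¬¬-maximum-avoiding : ¬ InA G y → ¬ ¬ Σ (Subset n) λ S → Maximum S × y ∉ S
  ¬¬-maximum-avoiding {y} y∉A ¬avoiding =
    y∉A λ S maxS → decidable-stable (y ∈? S) λ y∉S → ¬avoiding (S , maxS , y∉S)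

  -- The two complementary splices have ∣ P ∣ + ∣ Q ∣ vertices in total, so neither is smaller than Q.
  splice-maximum : ∀ {B P Q} → (∀ {p q} → p ∈ B → q ∉ B → p ~ q → q ≡ u) → u ∉ P → u ∉ Q →
    Maximum P → Maximum Q → Maximum (splice B P Q)
  splice-maximum {u = u} {B = B} {P = P} {Q = Q} boundary u∉P u∉Q maxP@(dP , isMaxP) maxQ@(dQ , _) =
    maximum-by-size maxQ (splice-dissociation dP dQ (no-crossing u∉Q))
      (m+n≡o+p∧n≤o⇒p≤m _ _ _ _ (∣splice∣+∣splice∣≡∣p∣+∣q∣ B P Q)
        (isMaxP _ (splice-dissociation dQ dP (no-crossing u∉P))))
    where
    no-crossing : ∀ {R R′} → u ∉ R′ → ∀ {p q} → p ∈ B → q ∉ B → p ~ q → p ∈ R → q ∈ R′ → ⊥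
    no-crossing u∉R′ p∈B q∉B p~q _ q∈R′ = u∉R′ (subst (_∈ _) (boundary p∈B q∉B p~q) q∈R′)

  maximum-non-extendable : ∀ {Z} → Maximum Z → u ∉ Z → ¬ Dissociation (Z ∪ ⁅ u ⁆)
  maximum-non-extendable {Z = Z} (_ , isMaxZ) u∉Z dZ+u =
    1+n≰n (subst (_≤ ∣ Z ∣) (x∉p⇒∣p∪⁅x⁆∣≡suc∣p∣ u∉Z) (isMaxZ _ dZ+u))

  InN-non-exchangeable : ∀ {Z} → InN G u → Maximum Z → y ∈ Z → ¬ Dissociation ((Z - y) ∪ ⁅ u ⁆)
  InN-non-exchangeable {u = u} {y = y} {Z = Z} uN maxZ y∈Z dZ-y+u =
    uN _ (maximum-by-size maxZ dZ-y+u ∣Z∣≤∣Z-y+u∣) (x∈p∪q⁺ (inj₂ (x∈⁅x⁆ u)))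
    where
    ∣Z∣≤∣Z-y+u∣ : ∣ Z ∣ ≤ ∣ (Z - y) ∪ ⁅ u ⁆ ∣
    ∣Z∣≤∣Z-y+u∣ = ≤-reflexive (begin
      ∣ Z ∣                 ≡⟨ x∈p⇒suc∣p-x∣≡∣p∣ y∈Z ⟨
      suc ∣ Z - y ∣         ≡⟨ x∉p⇒∣p∪⁅x⁆∣≡suc∣p∣ (uN Z maxZ ∘ p─q⊆p Z ⁅ y ⁆) ⟨
      ∣ (Z - y) ∪ ⁅ u ⁆ ∣ ∎)
      where open ≡-Reasoning

  InN⇒¬unique-neighbour-in-maximum : ∀ {Z} → InN G u → Maximum Z → x ∈ Z →
    ¬ (∀ {y} → y ∈ Z → u ~ y → y ≡ x)
  InN⇒¬unique-neighbour-in-maximum {u = u} {x = x} {Z = Z} uN maxZ@(dZ , _) x∈Z only-x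
    with any? (λ w → w ∈? Z ×-dec x ~? w)
  ... | no ¬w = maximum-non-extendable maxZ (uN Z maxZ)
                  (insert-dissociation dZ only-x λ z∈Z x~z → ¬w (_ , z∈Z , x~z))
  ... | yes (w , w∈Z , x~w) = InN-non-exchangeable uN maxZ w∈Z
                  (insert-dissociation (dissociation-⊆ Z-w⊆Z dZ) (only-x ∘ Z-w⊆Z) x-free)
    where
    Z-w⊆Z : Z - w ⊆ Z
    Z-w⊆Z = p─q⊆p Z ⁅ w ⁆
    x-free : ∀ {z} → z ∈ Z - w → ¬ x ~ z
    x-free z∈Z-w x~z = x∈p-y⇒x≢y Z z∈Z-w (dZ x _ w x∈Z (Z-w⊆Z z∈Z-w) w∈Z x~z x~w)

  InN⇒two-neighbours-in-maximum : ∀ {Z} → InN G u → Maximum Z →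
    ∃₂ λ x y → y ≢ x × u ~ x × u ~ y × x ∈ Z × y ∈ Z
  InN⇒two-neighbours-in-maximum {u = u} {Z = Z} uN maxZ@(dZ , _) with any? (λ x → x ∈? Z ×-dec u ~? x)
  ... | no ¬x = ⊥-elim (maximum-non-extendable maxZ (uN Z maxZ)
          (insert-dissociation {x = u} dZ (λ y∈Z u~y → ⊥-elim (¬x (_ , y∈Z , u~y))) λ z∈Z u~z → ¬x (_ , z∈Z , u~z)))
  ... | yes (x , x∈Z , u~x) with any? (λ y → y ∈? Z ×-dec u ~? y ×-dec ¬? (y ≟ x))
  ...   | yes (y , y∈Z , u~y , y≢x) = x , y , y≢x , u~x , u~y , x∈Z , y∈Z
  ...   | no ¬y = ⊥-elim (InN⇒¬unique-neighbour-in-maximum uN maxZ x∈Z λ y∈Z u~y →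
                    decidable-stable (_ ≟ x) λ y≢x → ¬y (_ , y∈Z , u~y , y≢x))

  InA⇒¬¬isolated⊎isolated-edge-end : InA G v → ¬ ¬ (IsolatedInA G v ⊎ IsolatedEdgeEndInA G v)
  InA⇒¬¬isolated⊎isolated-edge-end {v} vA = do
    S , maxS ← ¬¬-maximum
    w? ← ¬¬-excluded-middle
    return (kind maxS w?)
    where
    kind : ∀ {S} → Maximum S → Dec (∃ λ w → InA G w × v ~ w) → IsolatedInA G v ⊎ IsolatedEdgeEndInA G v
    kind _ (no ¬w) = inj₁ (vA , λ w wA v~w → ¬w (w , wA , v~w))
    kind {S} maxS@(dS , _) (yes (w , wA , v~w)) = inj₂ (w , vA , wA , v~w ,
      (λ x xA v~x → dS v x w (vA S maxS) (xA S maxS) (wA S maxS) v~x v~w) ,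
      (λ x xA w~x → dS w x v (wA S maxS) (xA S maxS) (vA S maxS) w~x (~-sym v~w)))

  data Walk (b : Fin n) : Fin n → List (Fin n) → Set where
    []  : Walk b b []
    _∷_ : x ~ y → Walk b y ys → Walk b x (y ∷ ys)

  walk-suffix : Walk b x xs → y ∈ₗ x ∷ xs → ∃₂ λ k ys → Walk b y ys × drop k (x ∷ xs) ≡ y ∷ ys
  walk-suffix w       (here refl)  = 0 , _ , w , refl
  walk-suffix (_ ∷ w) (there y∈xs) = let k , ys , w′ , eq = walk-suffix w y∈xs in suc k , ys , w′ , eq

  walk-then-edge : Walk b x xs → b ~ a → Linked _~_ (x ∷ xs ∷ʳ a)
  walk-then-edge []        b~a = b~a ∷ [-]
  walk-then-edge (x~y ∷ w) b~a = x~y ∷ walk-then-edge w b~a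

  -- x lies in the component of G − a containing b.
  Branch : Fin n → Fin n → Fin n → Set
  Branch a b x = Σ (List (Fin n)) λ xs → Walk b x xs × Unique (x ∷ xs) × All (_≢ a) (x ∷ xs)

  branch-root : a ~ b → Branch a b b
  branch-root a~b = [] , [] , [] ∷ [] , ≢-sym (~⇒≢ a~b) ∷ []

  avoided∉branch : ¬ Branch a b a
  avoided∉branch (_ , _ , _ , a≢a ∷ _) = a≢a refl

  branch-step : Branch a b x → x ~ y → y ≢ a → Branch a b y
  branch-step {y = y} (xs , w , uniq , avoid) x~y y≢a with Any.any? (y ≟_) (_ ∷ xs)
  ... | yes y∈ = let k , ys , w′ , eq = walk-suffix w y∈
                 in ys , w′ , subst Unique eq (Uniqueₚ.drop⁺ k uniq) , subst (All _) eq (Allₚ.drop⁺ k avoid)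
  ... | no y∉  = _ ∷ xs , ~-sym x~y ∷ w , Allₚ.¬Any⇒All¬ _ y∉ ∷ uniq , y≢a ∷ avoid

  IsBranch : Fin n → Fin n → Subset n → Set
  IsBranch a b B = ∀ v → v ∈ B ⇔ Branch a b v

  branch-boundary : ∀ {B p q} → IsBranch a b B → p ∈ B → q ∉ B → p ~ q → q ≡ a
  branch-boundary {a} {q = q} B⇔ p∈B q∉B p~q =
    decidable-stable (q ≟ a) λ q≢a → q∉B (from (B⇔ q) (branch-step (to (B⇔ _) p∈B) p~q q≢a))

  branch-splice-maximum : ∀ {B P Q} → InN G u → IsBranch u x B → Maximum P → Maximum Q →
    Maximum (splice B P Q)
  branch-splice-maximum {P = P} {Q = Q} uN B⇔ maxP maxQ =
    splice-maximum (branch-boundary B⇔) (uN P maxP) (uN Q maxQ) maxP maxQ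

  module _ (acyclic : Acyclic G) where

    branch-neighbour-unique : a ~ b → Branch a b x → x ~ a → x ≡ b
    branch-neighbour-unique a~b (_ , [] , _) x~a = refl
    branch-neighbour-unique {a} {b} {x} a~b (xs , w@(_ ∷ _) , uniq , avoid) x~a = ⊥-elim (acyclic record
      { start    = a
      ; rest     = x ∷ xs
      ; long     = s≤s (s≤s z≤n)
      ; distinct = All.map ≢-sym avoid ∷ uniq
      ; closed   = ~-sym x~a ∷ walk-then-edge w (~-sym a~b)
      })

    triangle-free : x ~ y → y ~ z → ¬ z ~ x
    triangle-free x~y y~z z~x =
      ~⇒≢ y~z (sym (branch-neighbour-unique x~y (branch-step (branch-root x~y) y~z (~⇒≢ z~x)) z~x))

    -- Each neighbour y ∉ 𝒜 of u is expelled by splicing in, on the branch at y, a maximum set avoiding y.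
    ¬¬-maximum-with-A-neighbours : InN G u →
      ¬ ¬ Σ (Subset n) λ Z → Maximum Z × (∀ {y} → u ~ y → y ∈ Z → InA G y)
    ¬¬-maximum-with-A-neighbours {u} uN = do
      Z , maxZ , good ← ¬¬-good (allFin n)
      return (Z , maxZ , λ {y} → good (∈-allFin y))
      where
      Good : List (Fin n) → Subset n → Set
      Good L Z = Maximum Z × ∀ {y} → y ∈ₗ L → u ~ y → y ∈ Z → InA G y

      keep : ∀ {L Z} → Good L Z → (u ~ y → y ∈ Z → InA G y) → Good (y ∷ L) Z
      keep (maxZ , good) new = maxZ , λ where
        (here refl)  → new
        (there y∈L) → good y∈L

      swap-in : ∀ {L Z S B} → Good L Z → u ~ y → Maximum S → y ∉ S → IsBranch u y B →
        Good (y ∷ L) (splice B S Z)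
      swap-in {y = y} {L = L} {Z = Z} {S = S} {B = B} (maxZ , good) u~y maxS y∉S B⇔ =
        branch-splice-maximum uN B⇔ maxS maxZ , good′
        where
        good′ : ∀ {v} → v ∈ₗ y ∷ L → u ~ v → v ∈ splice B S Z → InA G v
        good′ {v} v∈ u~v v∈S′ with v ∈? B | v∈
        ... | yes v∈B | _ = ⊥-elim (y∉S (subst (_∈ S)
                  (branch-neighbour-unique u~y (to (B⇔ v) v∈B) (~-sym u~v)) (∈-spliceˡ⁻ v∈B v∈S′)))
        ... | no v∉B | here refl = ⊥-elim (v∉B (from (B⇔ y) (branch-root u~y)))
        ... | no v∉B | there v∈L = good v∈L u~v (∈-spliceʳ⁻ v∉B v∈S′)

      extend : ∀ {L Z} → Good L Z → Dec (u ~ y) → Dec (InA G y) → ¬ ¬ Σ (Subset n) (Good (y ∷ L))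
      extend good (no ¬u~y) _  = return (_ , keep good (⊥-elim ∘ ¬u~y))
      extend good _ (yes yA)   = return (_ , keep good λ _ _ → yA)
      extend {y} good (yes u~y) (no y∉A) = do
        S , maxS , y∉S ← ¬¬-maximum-avoiding y∉A
        B , B⇔ ← ¬¬-comprehension (Branch u y)
        return (splice B S _ , swap-in good u~y maxS y∉S B⇔)

      ¬¬-good : ∀ L → ¬ ¬ Σ (Subset n) (Good L)
      ¬¬-good [] = do
        Z , maxZ ← ¬¬-maximum
        return (Z , maxZ , λ ())
      ¬¬-good (y ∷ L) = do
        Z , good ← ¬¬-good L
        yA? ← ¬¬-excluded-middle
        extend good (u ~? y) yA?

    -- W and Z together have ∣ S ∣ + ∣ S′ ∣ − 1 vertices, so if W is smaller than S then Z is
    -- maximum; but x ∉ Z.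
    maximum-avoiding-neighbours : ∀ {S S′ B} → InA G x → Maximum S → w ∈ S → x ~ w → Maximum S′ → w ∉ S′ →
      IsBranch x w B → Σ (Subset n) λ W → Maximum W × (∀ {z} → z ∈ W → ¬ x ~ z)
    maximum-avoiding-neighbours {x = x} {w = w} {S = S} {S′} {B} xA maxS@(dS , _) w∈S x~w maxS′@(dS′ , _) w∉S′ B⇔ =
      decide (∣ S ∣ ≤? ∣ W ∣)
      where
      D = S′ - x
      W = splice B D S
      Z = splice B S D

      D⊆S′ : D ⊆ S′
      D⊆S′ = p─q⊆p S′ ⁅ x ⁆

      dD : Dissociation D
      dD = dissociation-⊆ D⊆S′ dS′

      boundary : ∀ {p q} → p ∈ B → q ∉ B → p ~ q → q ≡ x
      boundary = branch-boundary B⇔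

      B∋neighbour⇒≡w : ∀ {p} → p ∈ B → p ~ x → p ≡ w
      B∋neighbour⇒≡w p∈B p~x = branch-neighbour-unique x~w (to (B⇔ _) p∈B) p~x

      x∉B : x ∉ B
      x∉B = avoided∉branch ∘ to (B⇔ x)

      dW : Dissociation W
      dW = splice-dissociation dD dS λ p∈B q∉B p~q p∈D _ →
        w∉S′ (subst (_∈ S′) (B∋neighbour⇒≡w p∈B (subst (_ ~_) (boundary p∈B q∉B p~q) p~q)) (D⊆S′ p∈D))

      dZ : Dissociation Z
      dZ = splice-dissociation dS dD λ p∈B q∉B p~q _ q∈D → x∈p-y⇒x≢y S′ q∈D (boundary p∈B q∉B p~q)

      x-free-in-W : ∀ {z} → z ∈ W → ¬ x ~ z
      x-free-in-W {z} z∈W x~z with z ∈? B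
      ... | yes z∈B = w∉S′ (subst (_∈ S′) (B∋neighbour⇒≡w z∈B (~-sym x~z)) (D⊆S′ (∈-spliceˡ⁻ z∈B z∈W)))
      ... | no z∉B  = z∉B (subst (_∈ B) (sym (dS x z w (xA S maxS) (∈-spliceʳ⁻ z∉B z∈W) w∈S x~z x~w))
                                        (from (B⇔ w) (branch-root x~w)))

      x∉Z : x ∉ Z
      x∉Z x∈Z = x∈p-y⇒x≢y S′ (∈-spliceʳ⁻ x∉B x∈Z) refl

      ∣Z∣+suc∣W∣≡∣S∣+∣S′∣ : ∣ Z ∣ + suc ∣ W ∣ ≡ ∣ S ∣ + ∣ S′ ∣
      ∣Z∣+suc∣W∣≡∣S∣+∣S′∣ = begin
        ∣ Z ∣ + suc ∣ W ∣   ≡⟨ +-suc ∣ Z ∣ ∣ W ∣ ⟩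
        suc (∣ Z ∣ + ∣ W ∣) ≡⟨ cong suc (∣splice∣+∣splice∣≡∣p∣+∣q∣ B S D) ⟩
        suc (∣ S ∣ + ∣ D ∣) ≡⟨ +-suc ∣ S ∣ ∣ D ∣ ⟨
        ∣ S ∣ + suc ∣ D ∣   ≡⟨ cong (∣ S ∣ +_) (x∈p⇒suc∣p-x∣≡∣p∣ (xA S′ maxS′)) ⟩
        ∣ S ∣ + ∣ S′ ∣      ∎
        where open ≡-Reasoning

      decide : Dec (∣ S ∣ ≤ ∣ W ∣) → Σ (Subset n) λ W → Maximum W × (∀ {z} → z ∈ W → ¬ x ~ z)
      decide (yes ∣S∣≤∣W∣) = W , maximum-by-size maxS dW ∣S∣≤∣W∣ , x-free-in-W
      decide (no ∣S∣≰∣W∣)  = ⊥-elim (x∉Z (xA Z (maximum-by-size maxS′ dZ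
        (m+n≡o+p∧n≤o⇒p≤m _ _ _ _ ∣Z∣+suc∣W∣≡∣S∣+∣S′∣ (≰⇒> ∣S∣≰∣W∣)))))

    ¬¬-maximum-avoiding-neighbours : IsolatedInA G x → ¬ ¬ Σ (Subset n) λ S → Maximum S × (∀ {z} → z ∈ S → ¬ x ~ z)
    ¬¬-maximum-avoiding-neighbours {x} (xA , x-isolated) = do
      S , maxS ← ¬¬-maximum
      by-neighbour maxS (any? λ w → w ∈? S ×-dec x ~? w)
      where
      by-neighbour : ∀ {S} → Maximum S → Dec (∃ λ w → w ∈ S × x ~ w) →
        ¬ ¬ Σ (Subset n) λ S → Maximum S × (∀ {z} → z ∈ S → ¬ x ~ z)
      by-neighbour maxS (no ¬w) = return (_ , maxS , λ {z} z∈S x~z → ¬w (z , z∈S , x~z))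
      by-neighbour maxS (yes (w , w∈S , x~w)) = do
        S′ , maxS′ , w∉S′ ← ¬¬-maximum-avoiding λ wA → x-isolated w wA x~w
        B , B⇔ ← ¬¬-comprehension (Branch x w)
        return (maximum-avoiding-neighbours xA maxS w∈S x~w maxS′ w∉S′ B⇔)

    -- Otherwise splice into Z, on the branch at x, a maximum set in which x has no neighbours:
    -- then u has neighbours only x and y in it, x has no other neighbour, and y can be traded for u.
    InN⇒third-A-neighbour : InN G u → u ~ x → IsolatedInA G x → u ~ y → InA G y →
      ¬ ¬ ∃ λ z → u ~ z × InA G z × z ≢ x × z ≢ y
    InN⇒third-A-neighbour {u} {x} {y} uN u~x x-isolated u~y yA ¬third =
      ¬¬-maximum-with-A-neighbours uN λ (Z , maxZ , Z-good) →
      ¬¬-maximum-avoiding-neighbours x-isolated λ (S , maxS , x-free) →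
      ¬¬-comprehension (Branch u x) λ (B , B⇔) →
      exchange-y-for-u maxZ Z-good maxS x-free B⇔
      where
      exchange-y-for-u : ∀ {Z S B} → Maximum Z → (∀ {v} → u ~ v → v ∈ Z → InA G v) →
        Maximum S → (∀ {z} → z ∈ S → ¬ x ~ z) → IsBranch u x B → ⊥
      exchange-y-for-u {Z} {S} {B} maxZ Z-good maxS x-free B⇔ =
        InN-non-exchangeable uN maxZ′ (yA Z′ maxZ′)
          (insert-dissociation (dissociation-⊆ Z′-y⊆Z′ (proj₁ maxZ′)) only-x x-free′)
        where
        Z′ : Subset n
        Z′ = splice B S Z

        maxZ′ : Maximum Z′
        maxZ′ = branch-splice-maximum uN B⇔ maxS maxZ

        Z′-y⊆Z′ : Z′ - y ⊆ Z′
        Z′-y⊆Z′ = p─q⊆p Z′ ⁅ y ⁆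

        only-x : ∀ {v} → v ∈ Z′ - y → u ~ v → v ≡ x
        only-x {v} v∈Z′-y u~v with v ≟ x | v ∈? B
        ... | yes v≡x | _       = v≡x
        ... | no _    | yes v∈B = branch-neighbour-unique u~x (to (B⇔ v) v∈B) (~-sym u~v)
        ... | no v≢x  | no v∉B  = ⊥-elim (¬third (v , u~v , Z-good u~v (∈-spliceʳ⁻ v∉B (Z′-y⊆Z′ v∈Z′-y)) ,
                                                   v≢x , x∈p-y⇒x≢y Z′ v∈Z′-y))

        x-free′ : ∀ {z} → z ∈ Z′ - y → ¬ x ~ z
        x-free′ {z} z∈Z′-y x~z with z ≟ u
        ... | yes refl = uN Z maxZ (∈-spliceʳ⁻ (avoided∉branch ∘ to (B⇔ u)) (Z′-y⊆Z′ z∈Z′-y))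
        ... | no z≢u   = x-free (∈-spliceˡ⁻ z∈B (Z′-y⊆Z′ z∈Z′-y)) x~z
          where
          z∈B : z ∈ B
          z∈B = from (B⇔ z) (branch-step (branch-root u~x) x~z z≢u)

    InN⇒two-A-neighbours : InN G u → ¬ ¬ ∃₂ λ x y → y ≢ x × u ~ x × u ~ y × InA G x × InA G y
    InN⇒two-A-neighbours uN = do
      Z , maxZ , Z-good ← ¬¬-maximum-with-A-neighbours uN
      let x , y , y≢x , u~x , u~y , x∈Z , y∈Z = InN⇒two-neighbours-in-maximum uN maxZ
      return (x , y , y≢x , u~x , u~y , Z-good u~x x∈Z , Z-good u~y y∈Z)

    InN⇒4≤p+2q⊎p≡3 : InN G u → (P Q : Subset n) →
      (∀ v → v ∈ P ⇔ (u ~ v × IsolatedInA G v)) → (∀ v → v ∈ Q ⇔ (u ~ v × IsolatedEdgeEndInA G v)) →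
      4 ≤ ∣ P ∣ + 2 * ∣ Q ∣ ⊎ ∣ P ∣ ≡ 3
    InN⇒4≤p+2q⊎p≡3 {u} uN P Q P⇔ Q⇔ = decidable-stable (4 ≤? ∣ P ∣ + 2 * ∣ Q ∣ ⊎-dec ∣ P ∣ ≟ℕ 3) do
      x , y , y≢x , u~x , u~y , xA , yA ← InN⇒two-A-neighbours uN
      x-kind ← InA⇒¬¬isolated⊎isolated-edge-end xA
      y-kind ← InA⇒¬¬isolated⊎isolated-edge-end yA
      count y≢x u~x u~y x-kind y-kind
      where
      ∈P∪Q : u ~ v → IsolatedInA G v ⊎ IsolatedEdgeEndInA G v → v ∈ P ∪ Q
      ∈P∪Q u~v (inj₁ v-isolated) = x∈p∪q⁺ (inj₁ (from (P⇔ _) (u~v , v-isolated)))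
      ∈P∪Q u~v (inj₂ v-end)      = x∈p∪q⁺ (inj₂ (from (Q⇔ _) (u~v , v-end)))

      with-third : y ≢ x → u ~ x → IsolatedInA G x → u ~ y → IsolatedInA G y ⊎ IsolatedEdgeEndInA G y →
        ¬ ¬ (4 ≤ ∣ P ∣ + 2 * ∣ Q ∣ ⊎ ∣ P ∣ ≡ 3)
      with-third y≢x u~x x-isolated u~y y-kind = do
        let yA = Sum.[ proj₁ , proj₁ ∘ proj₂ ] y-kind
        z , u~z , zA , z≢x , z≢y ← InN⇒third-A-neighbour uN u~x x-isolated u~y yA
        z-kind ← InA⇒¬¬isolated⊎isolated-edge-end zA
        return (3≤p+q⇒4≤p+2q⊎p≡3 ∣ P ∣ ∣ Q ∣ (≤-trans
          (distinct∈p⇒3≤∣p∣ (∈P∪Q u~x (inj₁ x-isolated)) (∈P∪Q u~y y-kind) (∈P∪Q u~z z-kind) y≢x z≢x z≢y)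
          (∣p∪q∣≤∣p∣+∣q∣ P Q)))

      count : y ≢ x → u ~ x → u ~ y → IsolatedInA G x ⊎ IsolatedEdgeEndInA G x →
        IsolatedInA G y ⊎ IsolatedEdgeEndInA G y → ¬ ¬ (4 ≤ ∣ P ∣ + 2 * ∣ Q ∣ ⊎ ∣ P ∣ ≡ 3)
      count y≢x u~x u~y (inj₁ x-isolated) y-kind = with-third y≢x u~x x-isolated u~y y-kind
      count y≢x u~x u~y x-kind (inj₁ y-isolated) = with-third (≢-sym y≢x) u~y y-isolated u~x x-kind
      count y≢x u~x u~y (inj₂ x-end) (inj₂ y-end) = return (inj₁ (2≤q⇒4≤p+2q ∣ P ∣ ∣ Q ∣
        (distinct∈p⇒2≤∣p∣ (from (Q⇔ _) (u~x , x-end)) (from (Q⇔ _) (u~y , y-end)) y≢x)))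

    InN⇒3≤∣A∣ : InN G u → (A : Subset n) → (∀ v → v ∈ A ⇔ InA G v) → 3 ≤ ∣ A ∣
    InN⇒3≤∣A∣ {u} uN A A⇔ = decidable-stable (3 ≤? ∣ A ∣) do
      x , y , y≢x , u~x , u~y , xA , yA ← InN⇒two-A-neighbours uN
      x-kind ← InA⇒¬¬isolated⊎isolated-edge-end xA
      third y≢x u~x u~y yA x-kind
      where
      ∈A : InA G v → v ∈ A
      ∈A = from (A⇔ _)

      third : y ≢ x → u ~ x → u ~ y → InA G y → IsolatedInA G x ⊎ IsolatedEdgeEndInA G x → ¬ ¬ (3 ≤ ∣ A ∣)
      third y≢x u~x u~y yA (inj₁ x-isolated@(xA , _)) = do
        z , _ , zA , z≢x , z≢y ← InN⇒third-A-neighbour uN u~x x-isolated u~y yA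
        return (distinct∈p⇒3≤∣p∣ (∈A xA) (∈A yA) (∈A zA) y≢x z≢x z≢y)
      third {y = y} y≢x u~x u~y yA (inj₂ (w , xA , wA , x~w , _)) =
        return (distinct∈p⇒3≤∣p∣ (∈A xA) (∈A yA) (∈A wA) y≢x (≢-sym (~⇒≢ x~w)) w≢y)
        where
        w≢y : w ≢ y
        w≢y refl = triangle-free u~x x~w (~-sym u~y)

theorem3p8 : (n : ℕ) (G : Graph n) → IsTree G →
  ((u : Fin n) → InN G u → (P Q : Subset n) →
    (∀ v → (v ∈ P) ⇔ (Adj G u v × IsolatedInA G v)) →
    (∀ v → (v ∈ Q) ⇔ (Adj G u v × IsolatedEdgeEndInA G v)) →
    (4 ≤ ∣ P ∣ + 2 * ∣ Q ∣) ⊎ (∣ P ∣ ≡ 3))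
  × (Σ (Fin n) (InN G) → (A : Subset n) → (∀ v → (v ∈ A) ⇔ InA G v) → 3 ≤ ∣ A ∣)
theorem3p8 n G (_ , acyclic) =
  (λ u uN → InN⇒4≤p+2q⊎p≡3 G acyclic uN) , λ (u , uN) → InN⇒3≤∣A∣ G acyclic uN
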